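{- Let $q\in\mathbb{Z}\setminus\{0\}$ and let $w_n=w_n(0,1,q)$, i.e. $w_0=0$, $w_1=1$, $w_n=qw_{n-1}+w_{n-2}$. (i) If $q$ is odd, then $(w_n)$ modulo $4$ is residue complete, and $(w_n)$ modulo $2^n$ is not residue complete for every $n\ge3$. (ii) If $q$ is even, then $(w_n)$ modulo $2$ is residue complete, and $(w_n)$ modulo $2^n$ is not residue complete for every $n\ge2$.
   Context: A sequence is residue complete modulo $m$ if every residue class of $\mathbb{Z}_m$ occurs among its terms modulo $m$. -}

module Defs where

open import Data.Nat using (ℕ; zero; suc)
open import Data.Integer using (ℤ; +_; _+_; _*_; _-_)
open import Data.Integer.Divisibility using (_∣_)
open import Data.Product using (∃)

w : ℤ → ℕ → ℤ
w q zero = + 0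
w q (suc zero) = + 1
w q (suc (suc n)) = q * w q (suc n) + w q n

_≡_[mod_] : ℤ → ℤ → ℕ → Set
a ≡ b [mod m ] = (+ m) ∣ (a - b)

ResidueComplete : (ℕ → ℤ) → ℕ → Set
ResidueComplete s m = ∀ (r : ℕ) → r Data.Nat.< m → ∃ λ n → s n ≡ + r [mod m ]

-- Modulo m, the pair (w_n mod m, w_{n+1} mod m) evolves by a map that depends only on q mod m,
-- so residue completeness of (w_n) modulo m is decided by finitely many terms once this pair
-- returns to (0, 1). For odd q the pair modulo 8 has period 12, and inspecting one period shows
-- that every class modulo 4 occurs while the class 4 modulo 8 never does; for even q the pair
-- modulo 4 has period 4, every class modulo 2 occurs and the class 3 modulo 4 never does.
-- Missing a class modulo 8 (resp. 4) is inherited by every modulus 2^k it divides.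
module Submission where

open import Defs
open import Data.Nat using (ℕ; _≤_; _^_)
open import Data.Integer using (ℤ; +_)
open import Data.Integer.Divisibility using (_∣_)
open import Data.Product using (_×_)
open import Relation.Nullary using (¬_)
open import Relation.Binary.PropositionalEquality using (_≢_)

open import Function using (_∘_)
open import Data.Nat using (zero; suc; _<_; _%_; _/_; NonZero; z≤n; s≤s)
import Data.Nat as ℕ
import Data.Nat.Properties as ℕ
import Data.Nat.Divisibility as ℕ∣
open import Data.Nat.DivMod using (m%n<n; m≡m%n+[m/n]*n)
open import Data.Nat.GeneralisedArithmetic using (fold; fold-+)
open import Data.Integer using (_+_; _*_; _-_; ∣_∣; _%ℕ_; _/ℕ_)
import Data.Integer.Properties as ℤ
import Data.Integer.Divisibility.Signed as ℤ∣
open import Data.Integer.DivMod using (a≡a%ℕn+[a/ℕn]*n; n%ℕd<d)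
open import Data.Integer.Tactic.RingSolver using (solve-∀)
open import Data.Fin using (Fin; toℕ; fromℕ<)
open import Data.Fin.Properties using (all?; any?; toℕ<n; toℕ-fromℕ<)
open import Data.Product using (∃; _,_; proj₁; proj₂; map₂)
open import Relation.Nullary using (Dec; contradiction)
open import Relation.Nullary.Decidable
  using (map′; True; False; toWitness; toWitnessFalse; from-no)
open import Relation.Binary.PropositionalEquality
  using (_≡_; refl; sym; trans; cong; subst; module ≡-Reasoning)

open ≡-Reasoning

-- Since a ≡ b [mod m ] unfolds to divisibility of ∣ a - b ∣, Agda cannot infer a and b from a
-- congruence proof; hence the explicit and named implicit arguments throughout.
≡-mod⇒∣ : ∀ {m} a b → a ≡ b [mod m ] → + m ℤ∣.∣ (a - b)
≡-mod⇒∣ {m} a b = ℤ∣.∣ᵤ⇒∣ {+ m} {a - b}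

∣⇒≡-mod : ∀ {m} a b → + m ℤ∣.∣ (a - b) → a ≡ b [mod m ]
∣⇒≡-mod {m} a b = ℤ∣.∣⇒∣ᵤ {+ m} {a - b}

≡-mod-reflexive : ∀ {m a b} → a ≡ b → a ≡ b [mod m ]
≡-mod-reflexive {m} a≡b = subst (+ m ∣_) (sym (ℤ.i≡j⇒i-j≡0 a≡b)) (m ℕ∣.∣0)

≡-mod-refl : ∀ {m} a → a ≡ a [mod m ]
≡-mod-refl a = ≡-mod-reflexive {a = a} refl

≡-mod-sym : ∀ {m a b} → a ≡ b [mod m ] → b ≡ a [mod m ]
≡-mod-sym {m} {a} {b} = subst (m ℕ∣.∣_) (ℤ.∣i-j∣≡∣j-i∣ a b)

≡-mod-trans : ∀ {m a b c} → a ≡ b [mod m ] → b ≡ c [mod m ] → a ≡ c [mod m ]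
≡-mod-trans {m} {a} {b} {c} a≡b b≡c =
  ∣⇒≡-mod a c (subst (+ m ℤ∣.∣_) (ℤ.+-minus-telescope a b c)
    (ℤ∣.∣m∣n⇒∣m+n (≡-mod⇒∣ a b a≡b) (≡-mod⇒∣ b c b≡c)))

≡-mod-+ : ∀ {m a a′ b b′} → a ≡ a′ [mod m ] → b ≡ b′ [mod m ] → (a + b) ≡ (a′ + b′) [mod m ]
≡-mod-+ {m} {a} {a′} {b} {b′} a≡a′ b≡b′ =
  ∣⇒≡-mod (a + b) (a′ + b′) (subst (+ m ℤ∣.∣_) (sym (split a b a′ b′))
    (ℤ∣.∣m∣n⇒∣m+n (≡-mod⇒∣ a a′ a≡a′) (≡-mod⇒∣ b b′ b≡b′)))
  where
  split : ∀ a b a′ b′ → (a + b) - (a′ + b′) ≡ (a - a′) + (b - b′)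
  split = solve-∀

≡-mod-* : ∀ {m a a′ b b′} → a ≡ a′ [mod m ] → b ≡ b′ [mod m ] → (a * b) ≡ (a′ * b′) [mod m ]
≡-mod-* {m} {a} {a′} {b} {b′} a≡a′ b≡b′ =
  ∣⇒≡-mod (a * b) (a′ * b′) (subst (+ m ℤ∣.∣_) (sym (split a b a′ b′)) (ℤ∣.∣m∣n⇒∣m+n
    (ℤ∣.∣n⇒∣m*n a (≡-mod⇒∣ b b′ b≡b′)) (ℤ∣.∣m⇒∣m*n b′ (≡-mod⇒∣ a a′ a≡a′))))
  where
  split : ∀ a b a′ b′ → a * b - a′ * b′ ≡ a * (b - b′) + (a - a′) * b′
  split = solve-∀

≡-mod-∣ : ∀ {d m a b} → d ℕ∣.∣ m → a ≡ b [mod m ] → a ≡ b [mod d ]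
≡-mod-∣ = ℕ∣.∣-trans

≡-mod-%ℕ : ∀ a m .{{_ : NonZero m}} → a ≡ + (a %ℕ m) [mod m ]
≡-mod-%ℕ a m = ∣⇒≡-mod a (+ (a %ℕ m)) (ℤ∣.divides (a /ℕ m) (begin
  a - + (a %ℕ m)                             ≡⟨ cong (_- + (a %ℕ m)) (a≡a%ℕn+[a/ℕn]*n a m) ⟩
  (+ (a %ℕ m) + (a /ℕ m) * + m) - + (a %ℕ m) ≡⟨ cancel (+ (a %ℕ m)) ((a /ℕ m) * + m) ⟩
  (a /ℕ m) * + m                             ∎))
  where
  cancel : ∀ x y → (x + y) - x ≡ y
  cancel = solve-∀

∣-resp-≡-mod : ∀ {d m} a b → d ℕ∣.∣ m → a ≡ b [mod m ] → + d ∣ b → + d ∣ a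
∣-resp-≡-mod {d} {m} a b d∣m a≡b d∣b =
  ℤ∣.∣⇒∣ᵤ {+ d} {a} (subst (+ d ℤ∣.∣_) (restore a b)
    (ℤ∣.∣m∣n⇒∣m+n (≡-mod⇒∣ a b (≡-mod-∣ {a = a} {b} d∣m a≡b)) (ℤ∣.∣ᵤ⇒∣ {+ d} {b} d∣b)))
  where
  restore : ∀ a b → (a - b) + b ≡ a
  restore = solve-∀

_≡_[mod_]? : ∀ a b m → Dec (a ≡ b [mod m ])
a ≡ b [mod m ]? = m ℕ∣.∣? ∣ a - b ∣

^-monoʳ-∣ : ∀ m {j k} → j ≤ k → m ^ j ℕ∣.∣ m ^ k
^-monoʳ-∣ m {k = k} z≤n   = ℕ∣.1∣ (m ^ k)
^-monoʳ-∣ m (s≤s j≤k) = ℕ∣.*-monoʳ-∣ m (^-monoʳ-∣ m j≤k)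

fold-periodic : ∀ {ℓ} {A : Set ℓ} (z : A) f P .{{_ : NonZero P}} → fold z f P ≡ z →
                ∀ n → fold z f n ≡ fold z f (n % P)
fold-periodic z f P period n = begin
  fold z f n                              ≡⟨ cong (fold z f) (m≡m%n+[m/n]*n n P) ⟩
  fold z f (n % P ℕ.+ n / P ℕ.* P)        ≡⟨ fold-+ z f (n % P) ⟩
  fold (fold z f (n / P ℕ.* P)) f (n % P) ≡⟨ cong (λ x → fold x f (n % P)) (fold-multiple (n / P)) ⟩
  fold z f (n % P)                        ∎
  where
  fold-multiple : ∀ k → fold z f (k ℕ.* P) ≡ z
  fold-multiple zero    = refl
  fold-multiple (suc k) =
    trans (fold-+ z f P) (trans (cong (λ x → fold x f P) (fold-multiple k)) period)

residueComplete-cong : ∀ s t {m} → (∀ n → s n ≡ t n [mod m ]) →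
                       ResidueComplete s m → ResidueComplete t m
residueComplete-cong s t s≡t rc r r<m =
  map₂ (λ {n} → ≡-mod-trans {a = t n} {s n} (≡-mod-sym {a = s n} {t n} (s≡t n))) (rc r r<m)

residueComplete-∣ : ∀ s {d m} .{{_ : NonZero m}} → d ℕ∣.∣ m →
                    ResidueComplete s m → ResidueComplete s d
residueComplete-∣ s d∣m rc r r<d =
  map₂ (λ {n} → ≡-mod-∣ {a = s n} d∣m) (rc r (ℕ.<-≤-trans r<d (ℕ∣.∣⇒≤ d∣m)))

residueComplete? : ∀ (s : ℕ → ℤ) m P .{{_ : NonZero P}} → (∀ n → s n ≡ s (n % P)) →
                   Dec (ResidueComplete s m)
residueComplete? s m P periodic =
  map′ fromFin toFin (all? λ r → any? λ i → s (toℕ i) ≡ + toℕ r [mod m ]?)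
  where
  fromFin : (∀ (r : Fin m) → ∃ λ (i : Fin P) → s (toℕ i) ≡ + toℕ r [mod m ]) →
            ResidueComplete s m
  fromFin h r r<m with h (fromℕ< r<m)
  ... | i , e = toℕ i , subst (λ x → s (toℕ i) ≡ + x [mod m ]) (toℕ-fromℕ< r<m) e
  toFin : ResidueComplete s m → ∀ (r : Fin m) → ∃ λ (i : Fin P) → s (toℕ i) ≡ + toℕ r [mod m ]
  toFin rc r with rc (toℕ r) (toℕ<n r)
  ... | n , e = fromℕ< (m%n<n n P) , subst (λ x → x ≡ + toℕ r [mod m ])
    (trans (periodic n) (cong s (sym (toℕ-fromℕ< (m%n<n n P))))) e

wPairMod : (m : ℕ) .{{_ : NonZero m}} → ℕ → ℕ → ℕ × ℕ
wPairMod m c = fold (0 , 1) λ (a , b) → b , (c ℕ.* b ℕ.+ a) % m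

wMod : (m : ℕ) .{{_ : NonZero m}} → ℕ → ℕ → ℤ
wMod m c n = + proj₁ (wPairMod m c n)

w≡wMod : ∀ q c {m} .{{_ : NonZero m}} → q ≡ + c [mod m ] → ∀ n → w q n ≡ wMod m c n [mod m ]
w≡wMod q c {m} q≡c n = proj₁ (consecutive n)
  where
  recurrence : ∀ {x y} a b → x ≡ + b [mod m ] → y ≡ + a [mod m ] →
               (q * x + y) ≡ + ((c ℕ.* b ℕ.+ a) % m) [mod m ]
  recurrence {x} {y} a b x≡b y≡a =
    ≡-mod-trans {a = q * x + y} {+ c * + b + + a}
      (≡-mod-+ {a = q * x} {+ c * + b} {y} {+ a} (≡-mod-* {a = q} {+ c} {x} {+ b} q≡c x≡b) y≡a)
      (≡-mod-trans {a = + c * + b + + a} {+ (c ℕ.* b ℕ.+ a)}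
        (≡-mod-reflexive (sym pos-*-+)) (≡-mod-%ℕ (+ (c ℕ.* b ℕ.+ a)) m))
    where
    pos-*-+ : + (c ℕ.* b ℕ.+ a) ≡ + c * + b + + a
    pos-*-+ = trans (ℤ.pos-+ (c ℕ.* b) a) (cong (_+ + a) (ℤ.pos-* c b))
  consecutive : ∀ n → w q n ≡ + proj₁ (wPairMod m c n) [mod m ] ×
                      w q (suc n) ≡ + proj₂ (wPairMod m c n) [mod m ]
  consecutive zero    = ≡-mod-refl (+ 0) , ≡-mod-refl (+ 1)
  consecutive (suc n) with consecutive n
  ... | wn≡a , wsn≡b = wsn≡b , recurrence _ _ wsn≡b wn≡a

wMod-periodic : ∀ m .{{_ : NonZero m}} c P .{{_ : NonZero P}} → wPairMod m c P ≡ (0 , 1) →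
                ∀ n → wMod m c n ≡ wMod m c (n % P)
wMod-periodic m c P period n = cong (+_ ∘ proj₁) (fold-periodic _ _ P period n)

wMod-residueComplete? : ∀ m .{{_ : NonZero m}} c P .{{_ : NonZero P}} →
                        wPairMod m c P ≡ (0 , 1) → ∀ d → Dec (ResidueComplete (wMod m c) d)
wMod-residueComplete? m c P period d =
  residueComplete? (wMod m c) d P (wMod-periodic m c P period)

-- The implicit proofs of True and False below are found by the type checker evaluating the
-- decision procedure on concrete m, c and P, i.e. by running through one period.
w-residueComplete : ∀ q c {m d} .{{_ : NonZero m}} P .{{_ : NonZero P}} →
  q ≡ + c [mod m ] → d ℕ∣.∣ m → (period : wPairMod m c P ≡ (0 , 1)) →
  {True (wMod-residueComplete? m c P period d)} → ResidueComplete (w q) d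
w-residueComplete q c {m} {d} P q≡c d∣m period {complete} =
  residueComplete-cong (wMod m c) (w q)
    (λ n → ≡-mod-sym {a = w q n} (≡-mod-∣ {a = w q n} d∣m (w≡wMod q c q≡c n)))
    (toWitness {a? = wMod-residueComplete? m c P period d} complete)

w-residueIncomplete : ∀ q c {m} .{{_ : NonZero m}} P .{{_ : NonZero P}} →
  q ≡ + c [mod m ] → (period : wPairMod m c P ≡ (0 , 1)) →
  {False (wMod-residueComplete? m c P period m)} → ¬ ResidueComplete (w q) m
w-residueIncomplete q c {m} P q≡c period {incomplete} =
  toWitnessFalse {a? = wMod-residueComplete? m c P period m} incomplete
  ∘ residueComplete-cong (w q) (wMod m c) (w≡wMod q c q≡c)

¬residueComplete-^ : ∀ s b .{{_ : NonZero b}} j → ¬ ResidueComplete s (b ^ j) →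
                     ∀ k → j ≤ k → ¬ ResidueComplete s (b ^ k)
¬residueComplete-^ s b j ¬rc k j≤k = ¬rc ∘ residueComplete-∣ s {{ℕ.m^n≢0 b k}} (^-monoʳ-∣ b j≤k)

odd-residues : ∀ q c → c < 8 → ¬ (2 ℕ∣.∣ c) → q ≡ + c [mod 8 ] →
               ResidueComplete (w q) 4 × ¬ ResidueComplete (w q) 8
odd-residues q 1 _ _ q≡c =
  w-residueComplete q 1 12 q≡c (ℕ∣.divides 2 refl) refl , w-residueIncomplete q 1 12 q≡c refl
odd-residues q 3 _ _ q≡c =
  w-residueComplete q 3 12 q≡c (ℕ∣.divides 2 refl) refl , w-residueIncomplete q 3 12 q≡c refl
odd-residues q 5 _ _ q≡c =
  w-residueComplete q 5 12 q≡c (ℕ∣.divides 2 refl) refl , w-residueIncomplete q 5 12 q≡c refl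
odd-residues q 7 _ _ q≡c =
  w-residueComplete q 7 12 q≡c (ℕ∣.divides 2 refl) refl , w-residueIncomplete q 7 12 q≡c refl
odd-residues q 0 _ c-odd _ = contradiction (ℕ∣.divides 0 refl) c-odd
odd-residues q 2 _ c-odd _ = contradiction (ℕ∣.divides 1 refl) c-odd
odd-residues q 4 _ c-odd _ = contradiction (ℕ∣.divides 2 refl) c-odd
odd-residues q 6 _ c-odd _ = contradiction (ℕ∣.divides 3 refl) c-odd
odd-residues q (suc (suc (suc (suc (suc (suc (suc (suc _))))))))
  (s≤s (s≤s (s≤s (s≤s (s≤s (s≤s (s≤s (s≤s ()))))))))

even-residues : ∀ q c → c < 4 → 2 ℕ∣.∣ c → q ≡ + c [mod 4 ] →
                ResidueComplete (w q) 2 × ¬ ResidueComplete (w q) 4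
even-residues q 0 _ _ q≡c =
  w-residueComplete q 0 4 q≡c (ℕ∣.divides 2 refl) refl , w-residueIncomplete q 0 4 q≡c refl
even-residues q 2 _ _ q≡c =
  w-residueComplete q 2 4 q≡c (ℕ∣.divides 2 refl) refl , w-residueIncomplete q 2 4 q≡c refl
even-residues q 1 _ c-even _ = contradiction c-even (from-no (2 ℕ∣.∣? 1))
even-residues q 3 _ c-even _ = contradiction c-even (from-no (2 ℕ∣.∣? 3))
even-residues q (suc (suc (suc (suc _)))) (s≤s (s≤s (s≤s (s≤s ()))))

lemma4p1 : (q : ℤ) → q ≢ + 0 →
  ((¬ ((+ 2) ∣ q) → ResidueComplete (w q) 4 × (∀ (k : ℕ) → 3 ≤ k → ¬ ResidueComplete (w q) (2 ^ k)))
  × ((+ 2) ∣ q → ResidueComplete (w q) 2 × (∀ (k : ℕ) → 2 ≤ k → ¬ ResidueComplete (w q) (2 ^ k))))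
lemma4p1 q _ = odd , even
  where
  q≡q%8 : q ≡ + (q %ℕ 8) [mod 8 ]
  q≡q%8 = ≡-mod-%ℕ q 8
  q≡q%4 : q ≡ + (q %ℕ 4) [mod 4 ]
  q≡q%4 = ≡-mod-%ℕ q 4
  odd : ¬ (+ 2 ∣ q) → ResidueComplete (w q) 4 × (∀ k → 3 ≤ k → ¬ ResidueComplete (w q) (2 ^ k))
  odd q-odd = map₂ (¬residueComplete-^ (w q) 2 3) (odd-residues q (q %ℕ 8) (n%ℕd<d q 8)
    (q-odd ∘ ∣-resp-≡-mod q (+ (q %ℕ 8)) (ℕ∣.divides 4 refl) q≡q%8) q≡q%8)
  even : + 2 ∣ q → ResidueComplete (w q) 2 × (∀ k → 2 ≤ k → ¬ ResidueComplete (w q) (2 ^ k))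
  even q-even = map₂ (¬residueComplete-^ (w q) 2 2) (even-residues q (q %ℕ 4) (n%ℕd<d q 4)
    (∣-resp-≡-mod (+ (q %ℕ 4)) q (ℕ∣.divides 2 refl) (≡-mod-sym {a = q} q≡q%4) q-even) q≡q%4)
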